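{- Let $a>1$ and $k\ge 2$ be integers, and let $T^*=BS^*(a,a+1,\ldots,a+k)$. Then $T^*$ is transmission irregular.
   Context: The transmission of a vertex $v$ of a graph $G$ is ${\rm Tr}_G(v)=\sum_{u\in V(G)} d_G(u,v)$; $G$ is transmission irregular if all its vertices have pairwise different transmissions. The starlike tree $T(a,a+1,\ldots,a+k)$ is the tree obtained by attaching to a single vertex (its center, of degree $k+1$) $k+1$ pendant paths of lengths $a,a+1,\ldots,a+k$. The tree $BS^*(a,a+1,\ldots,a+k)$ is obtained from two disjoint copies of $T(a,a+1,\ldots,a+k)$ by adding an edge joining their two centers, and then attaching one new pendant vertex to one of these two centers (which then has degree $k+3$, the other having degree $k+2$). -}

module Defs where

open import Data.Nat using (ℕ; zero; suc; _+_; _≤_)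
open import Data.Fin using (Fin; toℕ)
open import Data.Bool using (Bool; true; false)
open import Data.Sum using (_⊎_)
open import Data.Product using (Σ; _×_; ∃)
open import Relation.Binary.PropositionalEquality using (_≡_)

data Walk {V : Set} (E : V → V → Set) : V → V → ℕ → Set where
  here : ∀ {u} → Walk E u u 0
  step : ∀ {u w v n} → E u w → Walk E w v n → Walk E u v (suc n)

Dist : {V : Set} → (V → V → Set) → V → V → ℕ → Set
Dist E u v d = Walk E u v d × (∀ m → Walk E u v m → d ≤ m)

sumFin : (n : ℕ) → (Fin n → ℕ) → ℕ
sumFin zero    f = 0
sumFin (suc n) f = f Fin.zero + sumFin n (λ i → f (Fin.suc i))

-- Vertices:
--   ctr b        : the two centers (b = true carries the extra pendant vertex)
--   pend         : the extra pendant vertex attached to ctr true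
--   pth b i j    : on the copy b, the pendant path number i (i = 0..k) has
--                  length a + i; j : Fin (a + i) is the vertex at distance
--                  j + 1 from the center ctr b.
data V (a k : ℕ) : Set where
  ctr  : Bool → V a k
  pend : V a k
  pth  : Bool → (i : Fin (suc k)) → Fin (a + toℕ i) → V a k

-- One orientation of each edge.
data Arc (a k : ℕ) : V a k → V a k → Set where
  centers : Arc a k (ctr true) (ctr false)
  pendant : Arc a k (ctr true) pend
  first   : ∀ b i (j : Fin (a + toℕ i)) → toℕ j ≡ 0 → Arc a k (ctr b) (pth b i j)
  along   : ∀ b i (j j' : Fin (a + toℕ i)) → toℕ j' ≡ suc (toℕ j) →
            Arc a k (pth b i j) (pth b i j')

Edge : (a k : ℕ) → V a k → V a k → Set
Edge a k u v = Arc a k u v ⊎ Arc a k v u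

sumV : (a k : ℕ) → (V a k → ℕ) → ℕ
sumV a k f = half true + half false + f pend
  where
  half : Bool → ℕ
  half b = f (ctr b) + sumFin (suc k) (λ i → sumFin (a + toℕ i) (λ j → f (pth b i j)))

IsTr : (a k : ℕ) → V a k → ℕ → Set
IsTr a k v t = Σ (V a k → ℕ) (λ f → (∀ u → Dist (Edge a k) u v (f u)) × (t ≡ sumV a k f))

TransmissionIrregular : (a k : ℕ) → Set
TransmissionIrregular a k =
  (∀ v → ∃ (IsTr a k v)) ×
  (∀ u v t → IsTr a k u t → IsTr a k v t → u ≡ v)

module Submission where

-- Write c₁ (= ctr true, carrying the pendant vertex p) and c₂ for the two centers, and
-- let branch i of either half be a path of L i = a + i vertices.  The proof is a direct
-- computation in three stages.
--  1. Distances.  δ below is the distance in closed form: it is realised by explicit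
--     walks, vanishes on the diagonal and changes by at most one along every edge, so it
--     bounds the length of every walk (walk-length-bound).
--  2. Transmissions.  Summing δ gives, with S = Σ L i, D = Σ_i Σ_j (j+1), K = 2D + S + 2:
--       Tr c₁ = K,  Tr c₂ = K + 1,  Tr p = K + 2S + 1,
--       Tr (vertex at depth y on branch i, half of c₁) = K + γ(y, R i)  (+ 1 in c₂'s half),
--     where γ(y, R) = y (y + 2 + 2R) and R i = S − L i.  The depth-y case subtracts the
--     "through the center" distances of the own branch and adds the along-branch ones.
--  3. Separation.  The levels 0, 2S + 1 and γ(y, R i) are pairwise at least 2 apart
--     unless they belong to the same position of the two halves (γ grows with the depth
--     faster than it can drop when R decreases between branches), and the offsets
--     ("side") are 0 or 1 and tell the halves apart; hence Tr is injective.

open import Defs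
open import Data.Nat using (ℕ; _<_; _≤_)
open import Data.Nat.Base using (zero; suc; _+_; _*_; _∸_; z≤n; s≤s; ∣_-_∣)
open import Data.Nat.Properties
open import Data.Nat.Tactic.RingSolver using (solve-∀)
open import Data.Fin using (Fin; toℕ; fromℕ<)
import Data.Fin as Fin
open import Data.Fin.Properties as FinP using (toℕ<n; toℕ-injective; toℕ-fromℕ<)
open import Data.Bool using (Bool; true; false)
open import Data.Sum using (_⊎_; inj₁; inj₂)
open import Data.Product using (_×_; _,_; proj₁; proj₂)
open import Data.Empty using (⊥-elim)
open import Relation.Binary.PropositionalEquality
open import Relation.Binary.Definitions using (tri<; tri≈; tri>)
open import Relation.Nullary using (¬_; Dec; yes; no)

sumFin-cong : ∀ n {f g : Fin n → ℕ} → (∀ i → f i ≡ g i) → sumFin n f ≡ sumFin n g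
sumFin-cong zero    f≗g = refl
sumFin-cong (suc n) f≗g = cong₂ _+_ (f≗g Fin.zero) (sumFin-cong n (λ i → f≗g (Fin.suc i)))

sumFin-+ : ∀ n (f g : Fin n → ℕ) → sumFin n (λ i → f i + g i) ≡ sumFin n f + sumFin n g
sumFin-+ zero    f g = refl
sumFin-+ (suc n) f g =
  trans (cong (f Fin.zero + g Fin.zero +_) (sumFin-+ n (λ i → f (Fin.suc i)) (λ i → g (Fin.suc i))))
        (interchange (f Fin.zero) (g Fin.zero) _ _)
  where
  interchange : ∀ x y u v → x + y + (u + v) ≡ x + u + (y + v)
  interchange = solve-∀

sumFin-const : ∀ n c → sumFin n (λ _ → c) ≡ n * c
sumFin-const zero    c = refl
sumFin-const (suc n) c = cong (c +_) (sumFin-const n c)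

sumFin-*ʳ : ∀ n (f : Fin n → ℕ) c → sumFin n (λ i → f i * c) ≡ sumFin n f * c
sumFin-*ʳ zero    f c = refl
sumFin-*ʳ (suc n) f c =
  trans (cong (f Fin.zero * c +_) (sumFin-*ʳ n (λ i → f (Fin.suc i)) c))
        (sym (*-distribʳ-+ c (f Fin.zero) _))

sumFin-suc : ∀ n (f : Fin n → ℕ) → sumFin n (λ i → suc (f i)) ≡ sumFin n f + n
sumFin-suc n f =
  trans (sumFin-cong n (λ i → +-comm 1 (f i)))
        (trans (sumFin-+ n f (λ _ → 1)) (cong (sumFin n f +_) (trans (sumFin-const n 1) (*-identityʳ n))))

summand≤sumFin : ∀ n (f : Fin n → ℕ) i → f i ≤ sumFin n f
summand≤sumFin (suc n) f Fin.zero    = m≤m+n _ _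
summand≤sumFin (suc n) f (Fin.suc i) = ≤-trans (summand≤sumFin n (λ i → f (Fin.suc i)) i) (m≤n+m _ _)

sumFin-exchange : ∀ n (f g : Fin n → ℕ) i₀ → (∀ i → ¬ i ≡ i₀ → f i ≡ g i) →
                  sumFin n f + g i₀ ≡ sumFin n g + f i₀
sumFin-exchange (suc n) f g Fin.zero f≗g =
  trans (cong (λ t → f Fin.zero + t + g Fin.zero)
              (sumFin-cong n (λ i → f≗g (Fin.suc i) (λ ()))))
        (swap (f Fin.zero) (g Fin.zero) _)
  where
  swap : ∀ x y u → x + u + y ≡ y + u + x
  swap = solve-∀
sumFin-exchange (suc n) f g (Fin.suc i₀) f≗g = begin
  f Fin.zero + F + g (Fin.suc i₀)   ≡⟨ cong (λ t → t + F + g (Fin.suc i₀)) (f≗g Fin.zero (λ ())) ⟩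
  g Fin.zero + F + g (Fin.suc i₀)   ≡⟨ +-assoc (g Fin.zero) F _ ⟩
  g Fin.zero + (F + g (Fin.suc i₀)) ≡⟨ cong (g Fin.zero +_) tail ⟩
  g Fin.zero + (G + f (Fin.suc i₀)) ≡⟨ +-assoc (g Fin.zero) G _ ⟨
  g Fin.zero + G + f (Fin.suc i₀)   ∎
  where
  open ≡-Reasoning
  F G : ℕ
  F = sumFin n (λ i → f (Fin.suc i))
  G = sumFin n (λ i → g (Fin.suc i))
  tail : F + g (Fin.suc i₀) ≡ G + f (Fin.suc i₀)
  tail = sumFin-exchange n (λ i → f (Fin.suc i)) (λ i → g (Fin.suc i)) i₀
           (λ i i≢i₀ → f≗g (Fin.suc i) (λ e → i≢i₀ (FinP.suc-injective e)))

tri : ℕ → ℕ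
tri n = sumFin n toℕ

tri-suc : ∀ m → tri (suc m) ≡ tri m + m
tri-suc m = sumFin-suc m toℕ

tri-+ : ∀ m n → tri (m + n) ≡ tri m + tri n + m * n
tri-+ zero    n = sym (+-identityʳ (tri n))
tri-+ (suc m) n = begin
  tri (suc m + n)                   ≡⟨ tri-suc (m + n) ⟩
  tri (m + n) + (m + n)             ≡⟨ cong (_+ (m + n)) (tri-+ m n) ⟩
  tri m + tri n + m * n + (m + n)   ≡⟨ regroup (tri m) (tri n) m n ⟩
  tri m + m + tri n + (n + m * n)   ≡⟨ cong (λ t → t + tri n + (n + m * n)) (tri-suc m) ⟨
  tri (suc m) + tri n + suc m * n   ∎
  where
  open ≡-Reasoning
  regroup : ∀ A B m n → A + B + m * n + (m + n) ≡ A + m + B + (n + m * n)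
  regroup = solve-∀

tri-mono : ∀ {m n} → m ≤ n → tri m ≤ tri n
tri-mono {m} m≤n with m≤n⇒∃[o]m+o≡n m≤n
... | e , refl = subst (tri m ≤_) (sym (tri-+ m e)) (≤-trans (m≤m+n (tri m) (tri e)) (m≤m+n _ _))

product≤tri : ∀ i s → suc i * suc s ≤ tri (suc (suc (i + s)))
product≤tri i zero = begin
  suc i * 1                   ≡⟨ *-identityʳ (suc i) ⟩
  suc i                       ≤⟨ s≤s (m≤m+n i 0) ⟩
  suc (i + 0)                 ≤⟨ m≤n+m _ _ ⟩
  tri (suc (i + 0)) + suc (i + 0) ≡⟨ tri-suc (suc (i + 0)) ⟨
  tri (suc (suc (i + 0)))     ∎
  where open ≤-Reasoning
product≤tri i (suc s) = begin
  suc i * suc (suc s)                  ≡⟨ one-more-row i s ⟩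
  suc i * suc s + suc i                ≤⟨ +-mono-≤ (product≤tri i s) (s≤s (≤-trans (n≤1+n i) (s≤s (m≤m+n i s)))) ⟩
  tri (suc (suc (i + s))) + suc (suc (i + s)) ≡⟨ tri-suc (suc (suc (i + s))) ⟨
  tri (suc (suc (suc (i + s))))        ≡⟨ cong (λ t → tri (suc (suc t))) (+-suc i s) ⟨
  tri (suc (suc (i + suc s)))          ∎
  where
  open ≤-Reasoning
  one-more-row : ∀ i s → suc i * suc (suc s) ≡ suc i * suc s + suc i
  one-more-row = solve-∀

≤tri+1 : ∀ m → m ≤ tri m + 1
≤tri+1 zero    = z≤n
≤tri+1 (suc m) = begin
  suc m           ≡⟨ +-comm 1 m ⟩
  m + 1           ≤⟨ +-monoˡ-≤ 1 (m≤n+m m (tri m)) ⟩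
  tri m + m + 1   ≡⟨ cong (_+ 1) (tri-suc m) ⟨
  tri (suc m) + 1 ∎
  where open ≤-Reasoning

sum-∣-∣ : ∀ x r → sumFin (x + r) (λ j → ∣ toℕ j - x ∣) ≡ tri (suc x) + tri r
sum-∣-∣ zero    r = sumFin-cong r (λ j → ∣-∣-identityʳ (toℕ j))
sum-∣-∣ (suc x) r = begin
  suc x + sumFin (x + r) (λ j → ∣ toℕ j - x ∣) ≡⟨ cong (suc x +_) (sum-∣-∣ x r) ⟩
  suc x + (tri (suc x) + tri r)                ≡⟨ regroup (tri (suc x)) (tri r) x ⟩
  tri (suc x) + suc x + tri r                  ≡⟨ cong (_+ tri r) (tri-suc (suc x)) ⟨
  tri (suc (suc x)) + tri r                    ∎
  where
  open ≡-Reasoning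
  regroup : ∀ A B x → suc x + (A + B) ≡ A + suc x + B
  regroup = solve-∀

path-distance-sum : ∀ x L → x < L →
                    sumFin L (λ j → ∣ toℕ j - x ∣) + L * suc x + suc x ≡ (tri L + L) + suc x * suc x
path-distance-sum x L x<L with m≤n⇒∃[o]m+o≡n x<L
... | r , refl = begin
  sumFin (suc x + r) (λ j → ∣ toℕ j - x ∣) + (suc x + r) * suc x + suc x
    ≡⟨ cong (λ t → sumFin t (λ j → ∣ toℕ j - x ∣) + t * suc x + suc x) (+-suc x r) ⟨
  sumFin (x + suc r) (λ j → ∣ toℕ j - x ∣) + (x + suc r) * suc x + suc x
    ≡⟨ cong (λ t → t + (x + suc r) * suc x + suc x) (sum-∣-∣ x (suc r)) ⟩
  tri (suc x) + tri (suc r) + (x + suc r) * suc x + suc x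
    ≡⟨ cong (λ t → t + tri (suc r) + (x + suc r) * suc x + suc x) (tri-suc x) ⟩
  tri x + x + tri (suc r) + (x + suc r) * suc x + suc x
    ≡⟨ regroup (tri x) (tri (suc r)) x r ⟩
  tri x + tri (suc r) + x * suc r + (x + suc r) + suc x * suc x
    ≡⟨ cong (λ t → t + (x + suc r) + suc x * suc x) (tri-+ x (suc r)) ⟨
  tri (x + suc r) + (x + suc r) + suc x * suc x
    ≡⟨ cong (λ t → tri t + t + suc x * suc x) (+-suc x r) ⟩
  tri (suc x + r) + (suc x + r) + suc x * suc x ∎
  where
  open ≡-Reasoning
  regroup : ∀ A B x r → A + x + B + (x + suc r) * suc x + suc x ≡ A + B + x * suc r + (x + suc r) + suc x * suc x
  regroup = solve-∀

-- The level polynomial γ(y, R) = y (y + 2 + 2R): a path vertex at distance y from its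
-- center, on a branch whose complement in its half has R vertices, has transmission
-- (constant) + γ(y, R).
γ : ℕ → ℕ → ℕ
γ y R = y * (y + 2 + (R + R))

γ-mono : ∀ {y y'} R → y ≤ y' → γ y R ≤ γ y' R
γ-mono R y≤y' = *-mono-≤ y≤y' (+-monoˡ-≤ (R + R) (+-monoˡ-≤ 2 y≤y'))

γ-deeper : ∀ y R e → γ y R + 2 ≤ γ (suc y) (R + e)
γ-deeper y R e = ≤-trans (m≤m+n _ _) (≤-reflexive (sym (expand y R e)))
  where
  expand : ∀ y R e → suc y * (suc y + 2 + ((R + e) + (R + e)))
                     ≡ (y * (y + 2 + (R + R)) + 2) + (e * y + e * y + y + y + 1 + R + R + e + e)
  expand = solve-∀

γ-deeper-across : ∀ y s R → y * s ≤ R → γ y (R + suc s) + 2 ≤ γ (suc y) R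
γ-deeper-across y s R ys≤R with m≤n⇒∃[o]m+o≡n ys≤R
... | e , refl = ≤-trans (m≤m+n _ _) (≤-reflexive (sym (expand y s e)))
  where
  expand : ∀ y s e → suc y * (suc y + 2 + ((y * s + e) + (y * s + e)))
                     ≡ (y * (y + 2 + (((y * s + e) + suc s) + ((y * s + e) + suc s))) + 2) + (e + e + 1)
  expand = solve-∀

γ-wider : ∀ y R s → γ (suc y) R + 2 ≤ γ (suc y) (R + suc s)
γ-wider y R s = ≤-trans (m≤m+n _ _) (≤-reflexive (sym (expand y R s)))
  where
  expand : ∀ y R s → suc y * (suc y + 2 + ((R + suc s) + (R + suc s)))
                     ≡ (suc y * (suc y + 2 + (R + R)) + 2) + (s + s + y * (suc s + suc s))
  expand = solve-∀

Apart : ℕ → ℕ → Set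
Apart m n = m + 2 ≤ n ⊎ n + 2 ≤ m

apart-sym : ∀ {m n} → Apart m n → Apart n m
apart-sym (inj₁ p) = inj₂ p
apart-sym (inj₂ p) = inj₁ p

apart-offsets : ∀ {m n s t} → s ≤ 1 → t ≤ 1 → Apart m n → ¬ m + s ≡ n + t
apart-offsets {m} {n} {s} {t} s≤1 t≤1 (inj₁ gap) eq = <⇒≢ (below m n s t s≤1 gap) eq
  where
  below : ∀ m n s t → s ≤ 1 → m + 2 ≤ n → m + s < n + t
  below m n s t s≤1 gap = ≤-trans (subst (suc (m + s) ≤_) (sym (+-suc m 1)) (s≤s (+-monoʳ-≤ m s≤1)))
                                  (≤-trans gap (m≤m+n n t))
apart-offsets s≤1 t≤1 (inj₂ gap) eq = apart-offsets t≤1 s≤1 (inj₁ gap) (sym eq)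

Near : ℕ → ℕ → Set
Near x y = x ≤ suc y × y ≤ suc x

near-sym : ∀ {x y} → Near x y → Near y x
near-sym (p , q) = q , p

near-suc : ∀ x → Near x (suc x)
near-suc x = m≤n⇒m≤1+n (n≤1+n x) , ≤-refl

near-+ˡ : ∀ c {x y} → Near x y → Near (c + x) (c + y)
near-+ˡ c {x} {y} (p , q) =
  subst (c + x ≤_) (+-suc c y) (+-monoʳ-≤ c p) ,
  subst (c + y ≤_) (+-suc c x) (+-monoʳ-≤ c q)

near-+ʳ : ∀ c {x y} → Near x y → Near (x + c) (y + c)
near-+ʳ c {x} {y} n = subst₂ Near (+-comm c x) (+-comm c y) (near-+ˡ c n)

near-∣-∣ : ∀ x y → Near ∣ x - y ∣ ∣ suc x - y ∣
near-∣-∣ zero    zero    = near-suc 0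
near-∣-∣ zero    (suc y) = near-sym (near-suc y)
near-∣-∣ (suc x) zero    = near-suc (suc x)
near-∣-∣ (suc x) (suc y) = near-∣-∣ x y

-- Solving for a same-half sum X: the branch-exchange identity and the path-distance
-- identity combine into a closed form for X + L·y + y.
eliminate-own-branch : ∀ {X C A D R L} y → X + (C + L * y) ≡ D + (R + L) * y + A → A + L * y + y ≡ C + y * y →
                       X + L * y + y ≡ D + R * y + y * y
eliminate-own-branch {X} {C} {A} {D} {R} {L} y exchange own-branch = +-cancelʳ-≡ (C + L * y) _ _ (begin
  X + L * y + y + (C + L * y)            ≡⟨ regroup₁ X C L y ⟩
  X + (C + L * y) + (L * y + y)          ≡⟨ cong (_+ (L * y + y)) exchange ⟩
  D + (R + L) * y + A + (L * y + y)      ≡⟨ regroup₂ D R L y A ⟩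
  A + L * y + y + (D + R * y + L * y)    ≡⟨ cong (_+ (D + R * y + L * y)) own-branch ⟩
  C + y * y + (D + R * y + L * y)        ≡⟨ regroup₃ C y D R L ⟩
  D + R * y + y * y + (C + L * y)        ∎)
  where
  open ≡-Reasoning
  regroup₁ : ∀ X C L y → X + L * y + y + (C + L * y) ≡ X + (C + L * y) + (L * y + y)
  regroup₁ = solve-∀
  regroup₂ : ∀ D R L y A → D + (R + L) * y + A + (L * y + y) ≡ A + L * y + y + (D + R * y + L * y)
  regroup₂ = solve-∀
  regroup₃ : ∀ C y D R L → C + y * y + (D + R * y + L * y) ≡ D + R * y + y * y + (C + L * y)
  regroup₃ = solve-∀

-- Assembling the transmission of a path vertex at depth y from its same-half sum X:
-- the center of its half, the other half (at distance y + 1 + depth), and the pendant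
-- vertex.  First component: vertex in the half carrying the pendant; second: the other half.
assemble-transmission : ∀ {X D S R L} y → S ≡ R + L → X + L * y + y ≡ D + R * y + y * y →
  ((y + 0 + X) + ((y + 1) + (D + S * suc y)) + suc (y + 0) ≡ (D + D + S + 2) + (γ y R + 0)) ×
  (((y + 1) + (D + S * suc y)) + (y + 0 + X) + suc (y + 1) ≡ (D + D + S + 2) + (γ y R + 1))
assemble-transmission {X} {D} {_} {R} {L} y refl X-closed = near-half , far-half
  where
  open ≡-Reasoning
  rest : ℕ
  rest = D + R * y + R + L + y + y + 2
  split : ∀ X D R L y → (y + 0 + X) + ((y + 1) + (D + (R + L) * suc y)) + suc (y + 0)
                        ≡ (X + L * y + y) + (D + R * y + R + L + y + y + 2)
  split = solve-∀
  collect : ∀ D R L y → (D + R * y + y * y) + (D + R * y + R + L + y + y + 2)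
                        ≡ (D + D + (R + L) + 2) + (y * (y + 2 + (R + R)) + 0)
  collect = solve-∀
  swap-halves : ∀ X D R L y → ((y + 1) + (D + (R + L) * suc y)) + (y + 0 + X) + suc (y + 1)
                              ≡ suc ((y + 0 + X) + ((y + 1) + (D + (R + L) * suc y)) + suc (y + 0))
  swap-halves = solve-∀
  add-one : ∀ K G → suc (K + (G + 0)) ≡ K + (G + 1)
  add-one = solve-∀
  near-half : (y + 0 + X) + ((y + 1) + (D + (R + L) * suc y)) + suc (y + 0) ≡ (D + D + (R + L) + 2) + (γ y R + 0)
  near-half = begin
    (y + 0 + X) + ((y + 1) + (D + (R + L) * suc y)) + suc (y + 0) ≡⟨ split X D R L y ⟩
    (X + L * y + y) + rest                                        ≡⟨ cong (_+ rest) X-closed ⟩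
    (D + R * y + y * y) + rest                                    ≡⟨ collect D R L y ⟩
    (D + D + (R + L) + 2) + (γ y R + 0)                           ∎
  far-half : ((y + 1) + (D + (R + L) * suc y)) + (y + 0 + X) + suc (y + 1) ≡ (D + D + (R + L) + 2) + (γ y R + 1)
  far-half = begin
    ((y + 1) + (D + (R + L) * suc y)) + (y + 0 + X) + suc (y + 1) ≡⟨ swap-halves X D R L y ⟩
    suc ((y + 0 + X) + ((y + 1) + (D + (R + L) * suc y)) + suc (y + 0)) ≡⟨ cong suc near-half ⟩
    suc ((D + D + (R + L) + 2) + (γ y R + 0))                     ≡⟨ add-one (D + D + (R + L) + 2) (γ y R) ⟩
    (D + D + (R + L) + 2) + (γ y R + 1)                           ∎

first-level<pendant : ∀ R L → 2 ≤ L → γ 1 R + 2 ≤ suc ((R + L) + (R + L))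
first-level<pendant R L 2≤L with m≤n⇒∃[o]m+o≡n 2≤L
... | e , refl = ≤-trans (m≤m+n _ (e + e)) (≤-reflexive (sym (expand R e)))
  where
  expand : ∀ R e → suc ((R + (2 + e)) + (R + (2 + e))) ≡ (1 * (1 + 2 + (R + R)) + 2) + (e + e)
  expand = solve-∀

pendant<second-level : ∀ R L → L ≤ suc R → suc ((R + L) + (R + L)) + 2 ≤ γ 2 R
pendant<second-level R L L≤R+1 = begin
  suc ((R + L) + (R + L)) + 2             ≤⟨ +-monoˡ-≤ 2 (s≤s (+-mono-≤ (+-monoʳ-≤ R L≤R+1) (+-monoʳ-≤ R L≤R+1))) ⟩
  suc ((R + suc R) + (R + suc R)) + 2     ≤⟨ m≤m+n _ 3 ⟩
  suc ((R + suc R) + (R + suc R)) + 2 + 3 ≡⟨ expand R ⟩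
  γ 2 R                                   ∎
  where
  open ≤-Reasoning
  expand : ∀ R → suc ((R + suc R) + (R + suc R)) + 2 + 3 ≡ 2 * (2 + 2 + (R + R))
  expand = solve-∀

module _ {Vtx : Set} {E : Vtx → Vtx → Set} where

  _++ʷ_ : ∀ {u w v m n} → Walk E u w m → Walk E w v n → Walk E u v (m + n)
  here     ++ʷ q = q
  step e p ++ʷ q = step e (p ++ʷ q)

  snocʷ : ∀ {u w v n} → Walk E u w n → E w v → Walk E u v (suc n)
  snocʷ here        e = step e here
  snocʷ (step e' p) e = step e' (snocʷ p e)

  castʷ : ∀ {u v m n} → m ≡ n → Walk E u v m → Walk E u v n
  castʷ refl p = p

  reverseʷ : (∀ {u v} → E u v → E v u) → ∀ {u v n} → Walk E u v n → Walk E v u n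
  reverseʷ flip here       = here
  reverseʷ flip (step e p) = snocʷ (reverseʷ flip p) (flip e)

  walk-length-bound : (δ : Vtx → Vtx → ℕ) → (∀ v → δ v v ≡ 0) →
                      (∀ {u w} → E u w → ∀ v → δ u v ≤ suc (δ w v)) →
                      ∀ {u v m} → Walk E u v m → δ u v ≤ m
  walk-length-bound δ δ-diag δ-step {u} here = ≤-reflexive (δ-diag u)
  walk-length-bound δ δ-diag δ-step {v = v} (step e p) =
    ≤-trans (δ-step e v) (s≤s (walk-length-bound δ δ-diag δ-step p))

  dist-unique : ∀ {u v d d'} → Dist E u v d → Dist E u v d' → d ≡ d'
  dist-unique (w , min) (w' , min') = ≤-antisym (min _ w') (min' _ w)

module Tree (a k : ℕ) where

  Vertex : Set
  Vertex = V a k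

  E : Vertex → Vertex → Set
  E = Edge a k

  flip-edge : ∀ {u v} → E u v → E v u
  flip-edge (inj₁ arc) = inj₂ arc
  flip-edge (inj₂ arc) = inj₁ arc

  L : Fin (suc k) → ℕ
  L i = a + toℕ i

  hop : Bool → Bool → ℕ
  hop true  true  = 0
  hop false false = 0
  hop true  false = 1
  hop false true  = 1

  sameHalf : ∀ i (j : Fin (L i)) i' (j' : Fin (L i')) → Dec (i ≡ i') → ℕ
  sameHalf i j i' j' (yes refl) = ∣ toℕ j - toℕ j' ∣
  sameHalf i j i' j' (no _)     = suc (toℕ j) + suc (toℕ j')

  pathDist : Bool → ∀ i (j : Fin (L i)) → Bool → ∀ i' (j' : Fin (L i')) → ℕ
  pathDist true  i j true  i' j' = sameHalf i j i' j' (i FinP.≟ i')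
  pathDist false i j false i' j' = sameHalf i j i' j' (i FinP.≟ i')
  pathDist true  i j false i' j' = suc (toℕ j) + 1 + suc (toℕ j')
  pathDist false i j true  i' j' = suc (toℕ j) + 1 + suc (toℕ j')

  δ : Vertex → Vertex → ℕ
  δ pend        pend          = 0
  δ pend        (ctr b)       = suc (hop true b)
  δ pend        (pth b i j)   = suc (suc (toℕ j) + hop true b)
  δ (ctr b)     pend          = suc (hop b true)
  δ (pth b i j) pend          = suc (suc (toℕ j) + hop b true)
  δ (ctr b)     (ctr b')      = hop b b'
  δ (ctr b)     (pth b' i j)  = suc (toℕ j) + hop b b'
  δ (pth b i j) (ctr b')      = suc (toℕ j) + hop b b'
  δ (pth b i j) (pth b' i' j') = pathDist b i j b' i' j'

  sameHalf-≡ : ∀ b i (j j' : Fin (L i)) → pathDist b i j b i j' ≡ ∣ toℕ j - toℕ j' ∣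
  sameHalf-≡ true  i j j' with i FinP.≟ i
  ... | yes refl = refl
  ... | no i≢i   = ⊥-elim (i≢i refl)
  sameHalf-≡ false i j j' with i FinP.≟ i
  ... | yes refl = refl
  ... | no i≢i   = ⊥-elim (i≢i refl)

  sameHalf-≢ : ∀ b i (j : Fin (L i)) i' (j' : Fin (L i')) → ¬ i ≡ i' →
               pathDist b i j b i' j' ≡ suc (toℕ j) + suc (toℕ j')
  sameHalf-≢ true  i j i' j' i≢i' with i FinP.≟ i'
  ... | yes i≡i' = ⊥-elim (i≢i' i≡i')
  ... | no _     = refl
  sameHalf-≢ false i j i' j' i≢i' with i FinP.≟ i'
  ... | yes i≡i' = ⊥-elim (i≢i' i≡i')
  ... | no _     = refl

  δ-diag : ∀ v → δ v v ≡ 0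
  δ-diag pend          = refl
  δ-diag (ctr true)    = refl
  δ-diag (ctr false)   = refl
  δ-diag (pth b i j)   = trans (sameHalf-≡ b i j j) (∣n-n∣≡0 (toℕ j))

  climb : ∀ b i e (j j' : Fin (L i)) → toℕ j' ≡ toℕ j + e → Walk E (pth b i j) (pth b i j') e
  climb b i zero j j' j'≡j = subst (λ t → Walk E (pth b i j) (pth b i t) 0)
                                   (toℕ-injective (trans (sym (+-identityʳ (toℕ j))) (sym j'≡j))) here
  climb b i (suc e) j j' j'≡j+1+e = step (inj₁ (along b i j j₁ (toℕ-fromℕ< j+1<L))) (climb b i e j₁ j' j'≡j₁+e)
    where
    j+1<L : suc (toℕ j) < L i
    j+1<L = ≤-<-trans (subst (suc (toℕ j) ≤_) (trans (sym (+-suc (toℕ j) e)) (sym j'≡j+1+e))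
                                              (s≤s (m≤m+n (toℕ j) e)))
                      (toℕ<n j')
    j₁ : Fin (L i)
    j₁ = fromℕ< j+1<L
    j'≡j₁+e : toℕ j' ≡ toℕ j₁ + e
    j'≡j₁+e = trans j'≡j+1+e (trans (+-suc (toℕ j) e) (cong (_+ e) (sym (toℕ-fromℕ< j+1<L))))

  from-center : ∀ b i (j : Fin (L i)) → Walk E (ctr b) (pth b i j) (suc (toℕ j))
  from-center b i j = step (inj₁ (first b i j₀ (toℕ-fromℕ< 0<L))) (climb b i (toℕ j) j₀ j j≡j₀+j)
    where
    0<L : 0 < L i
    0<L = ≤-<-trans z≤n (toℕ<n j)
    j₀ : Fin (L i)
    j₀ = fromℕ< 0<L
    j≡j₀+j : toℕ j ≡ toℕ j₀ + toℕ j
    j≡j₀+j = cong (_+ toℕ j) (sym (toℕ-fromℕ< 0<L))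

  to-center : ∀ b i (j : Fin (L i)) → Walk E (pth b i j) (ctr b) (suc (toℕ j))
  to-center b i j = reverseʷ flip-edge (from-center b i j)

  along-branch : ∀ b i (j j' : Fin (L i)) → Walk E (pth b i j) (pth b i j') ∣ toℕ j - toℕ j' ∣
  along-branch b i j j' with ≤-total (toℕ j) (toℕ j')
  ... | inj₁ j≤j' with m≤n⇒∃[o]m+o≡n j≤j'
  ...   | e , j+e≡j' = castʷ (sym (trans (cong (λ t → ∣ toℕ j - t ∣) (sym j+e≡j')) (∣m-m+n∣≡n (toℕ j) e)))
                             (climb b i e j j' (sym j+e≡j'))
  along-branch b i j j' | inj₂ j'≤j with m≤n⇒∃[o]m+o≡n j'≤j
  ...   | e , j'+e≡j = castʷ (sym (trans (∣-∣-comm (toℕ j) (toℕ j'))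
                                          (trans (cong (λ t → ∣ toℕ j' - t ∣) (sym j'+e≡j)) (∣m-m+n∣≡n (toℕ j') e))))
                             (reverseʷ flip-edge (climb b i e j' j (sym j'+e≡j)))

  between-centers : ∀ b b' → Walk E (ctr b) (ctr b') (hop b b')
  between-centers true  true  = here
  between-centers false false = here
  between-centers true  false = step (inj₁ centers) here
  between-centers false true  = step (inj₂ centers) here

  center-to-path : ∀ b b' i (j : Fin (L i)) → Walk E (ctr b) (pth b' i j) (suc (toℕ j) + hop b b')
  center-to-path b b' i j = castʷ (+-comm (hop b b') _) (between-centers b b' ++ʷ from-center b' i j)

  path-to-path : ∀ b i (j : Fin (L i)) b' i' (j' : Fin (L i')) → Walk E (pth b i j) (pth b' i' j') (pathDist b i j b' i' j')
  path-to-path true  i j true  i' j' with i FinP.≟ i'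
  ... | yes refl = along-branch true i j j'
  ... | no _     = to-center true i j ++ʷ from-center true i' j'
  path-to-path false i j false i' j' with i FinP.≟ i'
  ... | yes refl = along-branch false i j j'
  ... | no _     = to-center false i j ++ʷ from-center false i' j'
  path-to-path true  i j false i' j' =
    castʷ (sym (+-assoc (suc (toℕ j)) 1 _)) (to-center true i j ++ʷ (between-centers true false ++ʷ from-center false i' j'))
  path-to-path false i j true  i' j' =
    castʷ (sym (+-assoc (suc (toℕ j)) 1 _)) (to-center false i j ++ʷ (between-centers false true ++ʷ from-center true i' j'))

  shortest-walk : ∀ u v → Walk E u v (δ u v)
  shortest-walk pend        pend         = here
  shortest-walk pend        (ctr b)      = step (inj₂ pendant) (between-centers true b)
  shortest-walk pend        (pth b i j)  = step (inj₂ pendant) (center-to-path true b i j)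
  shortest-walk (ctr b)     pend         = snocʷ (between-centers b true) (inj₁ pendant)
  shortest-walk (pth b i j) pend         = snocʷ (to-center b i j ++ʷ between-centers b true) (inj₁ pendant)
  shortest-walk (ctr b)     (ctr b')     = between-centers b b'
  shortest-walk (ctr b)     (pth b' i j) = center-to-path b b' i j
  shortest-walk (pth b i j) (ctr b')     = to-center b i j ++ʷ between-centers b b'
  shortest-walk (pth b i j) (pth b' i' j') = path-to-path b i j b' i' j'

  near-first : ∀ b i (j : Fin (L i)) → toℕ j ≡ 0 → ∀ b' i' (j' : Fin (L i')) →
               Near (suc (toℕ j') + hop b b') (pathDist b i j b' i' j')
  near-first true i j j≡0 true i' j' with i FinP.≟ i'
  ... | yes refl rewrite j≡0 = subst₂ Near (sym (+-identityʳ _)) refl (near-sym (near-suc (toℕ j')))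
  ... | no _     rewrite j≡0 = subst₂ Near (sym (+-identityʳ _)) refl (near-suc (suc (toℕ j')))
  near-first false i j j≡0 false i' j' with i FinP.≟ i'
  ... | yes refl rewrite j≡0 = subst₂ Near (sym (+-identityʳ _)) refl (near-sym (near-suc (toℕ j')))
  ... | no _     rewrite j≡0 = subst₂ Near (sym (+-identityʳ _)) refl (near-suc (suc (toℕ j')))
  near-first true  i j j≡0 false i' j' rewrite j≡0 = subst₂ Near (+-comm 1 (suc (toℕ j'))) refl (near-suc (suc (suc (toℕ j'))))
  near-first false i j j≡0 true  i' j' rewrite j≡0 = subst₂ Near (+-comm 1 (suc (toℕ j'))) refl (near-suc (suc (suc (toℕ j'))))

  near-along : ∀ b i (j j' : Fin (L i)) → toℕ j' ≡ suc (toℕ j) → ∀ b' i' (j'' : Fin (L i')) →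
               Near (pathDist b i j b' i' j'') (pathDist b i j' b' i' j'')
  near-along true i j j' j'≡j+1 true i' j'' with i FinP.≟ i'
  ... | yes refl rewrite j'≡j+1 = near-∣-∣ (toℕ j) (toℕ j'')
  ... | no _     rewrite j'≡j+1 = near-+ʳ (suc (toℕ j'')) (near-suc (suc (toℕ j)))
  near-along false i j j' j'≡j+1 false i' j'' with i FinP.≟ i'
  ... | yes refl rewrite j'≡j+1 = near-∣-∣ (toℕ j) (toℕ j'')
  ... | no _     rewrite j'≡j+1 = near-+ʳ (suc (toℕ j'')) (near-suc (suc (toℕ j)))
  near-along true  i j j' j'≡j+1 false i' j'' rewrite j'≡j+1 = near-+ʳ (suc (toℕ j'')) (near-+ʳ 1 (near-suc (suc (toℕ j))))
  near-along false i j j' j'≡j+1 true  i' j'' rewrite j'≡j+1 = near-+ʳ (suc (toℕ j'')) (near-+ʳ 1 (near-suc (suc (toℕ j))))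

  near-arc : ∀ {x y} → Arc a k x y → ∀ v → Near (δ x v) (δ y v)
  near-arc centers pend            = near-suc 1
  near-arc centers (ctr true)      = near-suc 0
  near-arc centers (ctr false)     = near-sym (near-suc 0)
  near-arc centers (pth true i j)  = near-+ˡ (suc (toℕ j)) (near-suc 0)
  near-arc centers (pth false i j) = near-+ˡ (suc (toℕ j)) (near-sym (near-suc 0))
  near-arc pendant pend            = near-sym (near-suc 0)
  near-arc pendant (ctr b)         = near-suc _
  near-arc pendant (pth b i j)     = near-suc _
  near-arc (first b i j j≡0) pend        rewrite j≡0 = near-+ˡ 1 (near-suc _)
  near-arc (first b i j j≡0) (ctr b')    rewrite j≡0 = near-suc _
  near-arc (first b i j j≡0) (pth b' i' j') = near-first b i j j≡0 b' i' j'
  near-arc (along b i j j' j'≡j+1) pend     rewrite j'≡j+1 = near-+ˡ 1 (near-+ʳ (hop b true) (near-suc _))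
  near-arc (along b i j j' j'≡j+1) (ctr b') rewrite j'≡j+1 = near-+ʳ (hop b b') (near-suc _)
  near-arc (along b i j j' j'≡j+1) (pth b' i' j'') = near-along b i j j' j'≡j+1 b' i' j''

  δ-step : ∀ {u w} → E u w → ∀ v → δ u v ≤ suc (δ w v)
  δ-step (inj₁ arc) v = proj₁ (near-arc arc v)
  δ-step (inj₂ arc) v = proj₂ (near-arc arc v)

  distance : ∀ u v → Dist E u v (δ u v)
  distance u v = shortest-walk u v , λ m w → walk-length-bound δ δ-diag δ-step w

  Tr : Vertex → ℕ
  Tr v = sumV a k (λ u → δ u v)

  sumV-cong : ∀ {f f' : Vertex → ℕ} → (∀ w → f w ≡ f' w) → sumV a k f ≡ sumV a k f'
  sumV-cong {f} {f'} f≗f' = cong₂ _+_ (cong₂ _+_ (half true) (half false)) (f≗f' pend)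
    where
    half : ∀ b → f (ctr b) + sumFin (suc k) (λ i → sumFin (L i) (λ j → f (pth b i j)))
               ≡ f' (ctr b) + sumFin (suc k) (λ i → sumFin (L i) (λ j → f' (pth b i j)))
    half b = cong₂ _+_ (f≗f' (ctr b)) (sumFin-cong (suc k) (λ i → sumFin-cong (L i) (λ j → f≗f' (pth b i j))))

  transmission-unique : ∀ v t → IsTr a k v t → t ≡ Tr v
  transmission-unique v t (f , f-dist , t≡Σf) = trans t≡Σf (sumV-cong (λ u → dist-unique (f-dist u) (distance u v)))

  -- S: number of path vertices in one half; D: sum of their depths; K: Tr of ctr true.
  S D K : ℕ
  S = sumFin (suc k) L
  D = sumFin (suc k) (λ i → tri (L i) + L i)
  K = D + D + S + 2

  branch-depth-sum : ∀ n c → sumFin n (λ j → suc (toℕ j) + c) ≡ (tri n + n) + n * c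
  branch-depth-sum n c = trans (sumFin-+ n (λ j → suc (toℕ j)) (λ _ → c))
                               (cong₂ _+_ (sumFin-suc n toℕ) (sumFin-const n c))

  depth-sum : ∀ c → sumFin (suc k) (λ i → sumFin (L i) (λ j → suc (toℕ j) + c)) ≡ D + S * c
  depth-sum c = begin
    sumFin (suc k) (λ i → sumFin (L i) (λ j → suc (toℕ j) + c)) ≡⟨ sumFin-cong (suc k) (λ i → branch-depth-sum (L i) c) ⟩
    sumFin (suc k) (λ i → (tri (L i) + L i) + L i * c)          ≡⟨ sumFin-+ (suc k) (λ i → tri (L i) + L i) (λ i → L i * c) ⟩
    D + sumFin (suc k) (λ i → L i * c)                          ≡⟨ cong (D +_) (sumFin-*ʳ (suc k) L c) ⟩
    D + S * c                                                   ∎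
    where open ≡-Reasoning

  cross-half-sum : ∀ y → sumFin (suc k) (λ i → sumFin (L i) (λ j → suc (toℕ j) + 1 + y)) ≡ D + S * suc y
  cross-half-sum y = trans (sumFin-cong (suc k) (λ i → sumFin-cong (L i) (λ j → +-assoc (suc (toℕ j)) 1 y)))
                           (depth-sum (suc y))

  Tr-ctr-true : Tr (ctr true) ≡ K + 0
  Tr-ctr-true = trans (cong₂ (λ p q → (0 + p) + (1 + q) + 1) (depth-sum 0) (depth-sum 1)) (collect D S)
    where
    collect : ∀ D S → (0 + (D + S * 0)) + (1 + (D + S * 1)) + 1 ≡ D + D + S + 2 + 0
    collect = solve-∀

  Tr-ctr-false : Tr (ctr false) ≡ K + 1
  Tr-ctr-false = trans (cong₂ (λ p q → (1 + q) + (0 + p) + 2) (depth-sum 0) (depth-sum 1)) (collect D S)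
    where
    collect : ∀ D S → (1 + (D + S * 1)) + (0 + (D + S * 0)) + 2 ≡ D + D + S + 2 + 1
    collect = solve-∀

  Tr-pend : Tr pend ≡ K + (suc (S + S) + 0)
  Tr-pend = trans (cong₂ (λ p q → (1 + p) + (2 + q) + 0) (shifted 0) (shifted 1)) (collect D S)
    where
    shifted : ∀ c → sumFin (suc k) (λ i → sumFin (L i) (λ j → suc (suc (toℕ j) + c))) ≡ D + S * suc c
    shifted c = trans (sumFin-cong (suc k) (λ i → sumFin-cong (L i) (λ j → sym (+-suc (suc (toℕ j)) c))))
                      (depth-sum (suc c))
    collect : ∀ D S → (1 + (D + S * 1)) + (2 + (D + S * 2)) + 0 ≡ D + D + S + 2 + (suc (S + S) + 0)
    collect = solve-∀

  -- R i: number of path vertices of a half outside branch i, written so that it needs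
  -- no truncated subtraction (S-split below shows S = R i + L i).
  Q : ℕ
  Q = tri (suc k)

  R : Fin (suc k) → ℕ
  R i = k * a + (Q ∸ toℕ i)

  Q-split : ∀ i → Q ≡ (Q ∸ toℕ i) + toℕ i
  Q-split i = sym (m∸n+n≡m (summand≤sumFin (suc k) toℕ i))

  S-split : ∀ i → S ≡ R i + L i
  S-split i = begin
    sumFin (suc k) (λ i → a + toℕ i)  ≡⟨ sumFin-+ (suc k) (λ _ → a) toℕ ⟩
    sumFin (suc k) (λ _ → a) + Q      ≡⟨ cong₂ _+_ (sumFin-const (suc k) a) (Q-split i) ⟩
    suc k * a + ((Q ∸ toℕ i) + toℕ i) ≡⟨ regroup a k (Q ∸ toℕ i) (toℕ i) ⟩
    R i + L i                         ∎
    where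
    open ≡-Reasoning
    regroup : ∀ a k q t → suc k * a + (q + t) ≡ k * a + q + (a + t)
    regroup = solve-∀

  -- Transmission of a path vertex at depth x + 1 on branch i: K + g i x (+ 1 in the other half).
  g : Fin (suc k) → ℕ → ℕ
  g i x = γ (suc x) (R i)

  same-half-sum : ∀ b i₀ (j₀ : Fin (L i₀)) → ℕ
  same-half-sum b i₀ j₀ = sumFin (suc k) (λ i → sumFin (L i) (λ j → pathDist b i j b i₀ j₀))

  -- Closed form of the same-half sum: exchange the own branch's "through the center"
  -- distances for the along-branch ones (path-distance-sum), then solve.
  same-half-closed : ∀ b i₀ (j₀ : Fin (L i₀)) →
                     same-half-sum b i₀ j₀ + L i₀ * suc (toℕ j₀) + suc (toℕ j₀)
                     ≡ D + R i₀ * suc (toℕ j₀) + suc (toℕ j₀) * suc (toℕ j₀)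
  same-half-closed b i₀ j₀ = eliminate-own-branch {X = same-half-sum b i₀ j₀} {D = D} {R = R i₀} {L = L i₀} y exchange
                               (path-distance-sum x (L i₀) (toℕ<n j₀))
    where
    x y : ℕ
    x = toℕ j₀
    y = suc x
    exchange : same-half-sum b i₀ j₀ + ((tri (L i₀) + L i₀) + L i₀ * y)
               ≡ D + (R i₀ + L i₀) * y + sumFin (L i₀) (λ j → ∣ toℕ j - x ∣)
    exchange = begin
      same-half-sum b i₀ j₀ + ((tri (L i₀) + L i₀) + L i₀ * y)
        ≡⟨ cong (same-half-sum b i₀ j₀ +_) (branch-depth-sum (L i₀) y) ⟨
      same-half-sum b i₀ j₀ + sumFin (L i₀) (λ j → suc (toℕ j) + y)
        ≡⟨ sumFin-exchange (suc k) _ (λ i → sumFin (L i) (λ j → suc (toℕ j) + y)) i₀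
             (λ i i≢i₀ → sumFin-cong (L i) (λ j → sameHalf-≢ b i j i₀ j₀ i≢i₀)) ⟩
      sumFin (suc k) (λ i → sumFin (L i) (λ j → suc (toℕ j) + y)) + sumFin (L i₀) (λ j → pathDist b i₀ j b i₀ j₀)
        ≡⟨ cong₂ _+_ (trans (depth-sum y) (cong (λ s → D + s * y) (S-split i₀)))
                     (sumFin-cong (L i₀) (λ j → sameHalf-≡ b i₀ j j₀)) ⟩
      D + (R i₀ + L i₀) * y + sumFin (L i₀) (λ j → ∣ toℕ j - x ∣) ∎
      where open ≡-Reasoning

  Tr-path : ∀ b i₀ (j₀ : Fin (L i₀)) → Tr (pth b i₀ j₀) ≡ K + (g i₀ (toℕ j₀) + hop true b)
  Tr-path true i₀ j₀ =
    trans (cong (λ Z → (y + 0 + same-half-sum true i₀ j₀) + ((y + 1) + Z) + suc (y + 0)) (cross-half-sum y))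
          (proj₁ (assemble-transmission {same-half-sum true i₀ j₀} {D} {S} {R i₀} {L i₀} y (S-split i₀) (same-half-closed true i₀ j₀)))
    where
    y : ℕ
    y = suc (toℕ j₀)
  Tr-path false i₀ j₀ =
    trans (cong (λ Z → ((y + 1) + Z) + (y + 0 + same-half-sum false i₀ j₀) + suc (y + 1)) (cross-half-sum y))
          (proj₂ (assemble-transmission {same-half-sum false i₀ j₀} {D} {S} {R i₀} {L i₀} y (S-split i₀) (same-half-closed false i₀ j₀)))
    where
    y : ℕ
    y = suc (toℕ j₀)

  -- Every transmission is K + level + side, with side ∈ {0, 1} recording the half.
  level : Vertex → ℕ
  level (ctr _)     = 0
  level pend        = suc (S + S)
  level (pth _ i j) = g i (toℕ j)

  side : Vertex → ℕ
  side (ctr b)     = hop true b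
  side pend        = 0
  side (pth b _ _) = hop true b

  transmission : ∀ v → Tr v ≡ K + (level v + side v)
  transmission (ctr true)  = Tr-ctr-true
  transmission (ctr false) = Tr-ctr-false
  transmission pend        = Tr-pend
  transmission (pth b i j) = Tr-path b i j

  R-shift : ∀ i i' t → toℕ i' ≡ toℕ i + t → R i ≡ R i' + t
  R-shift i i' t i'≡i+t = trans (cong (k * a +_) drop) (sym (+-assoc (k * a) (Q ∸ toℕ i') t))
    where
    drop : Q ∸ toℕ i ≡ (Q ∸ toℕ i') + t
    drop = begin
      Q ∸ toℕ i                            ≡⟨ cong (_∸ toℕ i) (Q-split i') ⟩
      ((Q ∸ toℕ i') + toℕ i') ∸ toℕ i      ≡⟨ cong (λ n → ((Q ∸ toℕ i') + n) ∸ toℕ i) (trans i'≡i+t (+-comm (toℕ i) t)) ⟩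
      ((Q ∸ toℕ i') + (t + toℕ i)) ∸ toℕ i ≡⟨ cong (_∸ toℕ i) (+-assoc (Q ∸ toℕ i') t (toℕ i)) ⟨
      ((Q ∸ toℕ i') + t + toℕ i) ∸ toℕ i   ≡⟨ m+n∸n≡m ((Q ∸ toℕ i') + t) (toℕ i) ⟩
      (Q ∸ toℕ i') + t                     ∎
      where open ≡-Reasoning

  R-large : ∀ i i' s → toℕ i' ≡ toℕ i + suc s → L i * s ≤ R i'
  R-large i i' s i'≡i+s+1 = subst (_≤ R i') (sym (*-distribʳ-+ s a (toℕ i))) (+-mono-≤ as≤ka is≤Q-i')
    where
    i'≤k : toℕ i' ≤ k
    i'≤k = ≤-pred (toℕ<n i')
    s≤k : s ≤ k
    s≤k = ≤-trans (≤-trans (n≤1+n s) (m≤n+m (suc s) (toℕ i))) (subst (_≤ k) i'≡i+s+1 i'≤k)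
    as≤ka : a * s ≤ k * a
    as≤ka = subst (a * s ≤_) (*-comm a k) (*-monoʳ-≤ a s≤k)
    rectangle : suc (toℕ i) * suc s ≡ toℕ i * s + toℕ i'
    rectangle = trans (expand (toℕ i) s) (cong (toℕ i * s +_) (sym i'≡i+s+1))
      where
      expand : ∀ i s → suc i * suc s ≡ i * s + (i + suc s)
      expand = solve-∀
    is+i'≤Q : toℕ i * s + toℕ i' ≤ (Q ∸ toℕ i') + toℕ i'
    is+i'≤Q = subst₂ _≤_ rectangle (Q-split i')
                (≤-trans (product≤tri (toℕ i) s)
                         (tri-mono (s≤s (subst (_≤ k) (trans i'≡i+s+1 (+-suc (toℕ i) s)) i'≤k))))
    is≤Q-i' : toℕ i * s ≤ Q ∸ toℕ i'
    is≤Q-i' = +-cancelʳ-≤ (toℕ i') _ _ is+i'≤Q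

  L≤R+1 : 1 ≤ k → ∀ i → L i ≤ suc (R i)
  L≤R+1 1≤k i = begin
    a + toℕ i                 ≤⟨ +-mono-≤ a≤ka i≤Q-i+1 ⟩
    k * a + ((Q ∸ toℕ i) + 1) ≡⟨ +-suc-last (k * a) (Q ∸ toℕ i) ⟩
    suc (R i)                 ∎
    where
    open ≤-Reasoning
    +-suc-last : ∀ p q → p + (q + 1) ≡ suc (p + q)
    +-suc-last = solve-∀
    a≤ka : a ≤ k * a
    a≤ka = subst (_≤ k * a) (*-identityˡ a) (*-monoˡ-≤ a 1≤k)
    i≤k : toℕ i ≤ k
    i≤k = ≤-pred (toℕ<n i)
    -- 2i ≤ 2k ≤ tri k + 1 + k = Q + 1
    2i≤Q+1 : toℕ i + toℕ i ≤ (Q ∸ toℕ i) + 1 + toℕ i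
    2i≤Q+1 = ≤-trans (+-mono-≤ i≤k i≤k) (≤-trans (+-monoˡ-≤ k (≤tri+1 k))
               (≤-reflexive (trans (regroup (tri k) k)
                 (trans (cong (_+ 1) (trans (sym (tri-suc k)) (Q-split i))) (regroup′ (Q ∸ toℕ i) (toℕ i))))))
      where
      regroup : ∀ t k → t + 1 + k ≡ t + k + 1
      regroup = solve-∀
      regroup′ : ∀ q i → q + i + 1 ≡ q + 1 + i
      regroup′ = solve-∀
    i≤Q-i+1 : toℕ i ≤ (Q ∸ toℕ i) + 1
    i≤Q-i+1 = +-cancelʳ-≤ (toℕ i) _ _ 2i≤Q+1

  g-deeper : ∀ i i' x → x < L i → g i x + 2 ≤ g i' (suc x)
  g-deeper i i' x x<L with <-≤-connex (toℕ i) (toℕ i')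
  ... | inj₂ i'≤i with m≤n⇒∃[o]m+o≡n i'≤i
  ...   | e , i'+e≡i = subst (λ r → g i x + 2 ≤ γ (suc (suc x)) r) (sym (R-shift i' i e (sym i'+e≡i)))
                             (γ-deeper (suc x) (R i) e)
  g-deeper i i' x x<L | inj₁ i<i' with m≤n⇒∃[o]m+o≡n i<i'
  ...   | s , i+1+s≡i' = subst (λ r → γ (suc x) r + 2 ≤ g i' (suc x)) (sym (R-shift i i' (suc s) i'≡i+s+1))
                           (γ-deeper-across (suc x) s (R i')
                              (≤-trans (*-monoˡ-≤ s x<L) (R-large i i' s i'≡i+s+1)))
    where
    i'≡i+s+1 : toℕ i' ≡ toℕ i + suc s
    i'≡i+s+1 = trans (sym i+1+s≡i') (sym (+-suc (toℕ i) s))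

  g-later : ∀ i i' x → toℕ i < toℕ i' → g i' x + 2 ≤ g i x
  g-later i i' x i<i' with m≤n⇒∃[o]m+o≡n i<i'
  ... | s , i+1+s≡i' = subst (λ r → g i' x + 2 ≤ γ (suc x) r)
                             (sym (R-shift i i' (suc s) (trans (sym i+1+s≡i') (sym (+-suc (toℕ i) s)))))
                             (γ-wider x (R i') s)

  g-mono : ∀ i {x x'} → x ≤ x' → g i x ≤ g i x'
  g-mono i x≤x' = γ-mono (R i) (s≤s x≤x')

  g-separated : ∀ i x i' x' → x < L i → x' < L i' → (i ≡ i' × x ≡ x') ⊎ Apart (g i x) (g i' x')
  g-separated i x i' x' x<L x'<L' with <-cmp x x'
  ... | tri< x<x' _ _ = inj₂ (inj₁ (≤-trans (g-deeper i i' x x<L) (g-mono i' x<x')))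
  ... | tri> _ _ x'<x = inj₂ (inj₂ (≤-trans (g-deeper i' i x' x'<L') (g-mono i x'<x)))
  ... | tri≈ _ refl _ with <-cmp (toℕ i) (toℕ i')
  ...   | tri< i<i' _ _ = inj₂ (inj₂ (g-later i i' x i<i'))
  ...   | tri> _ _ i'<i = inj₂ (inj₁ (g-later i' i x i'<i))
  ...   | tri≈ _ i≡i' _ = inj₁ (toℕ-injective i≡i' , refl)

  2≤g : ∀ i x → 2 ≤ g i x
  2≤g i x = ≤-trans (m≤n+m 2 (suc x)) (≤-trans (m≤m+n (suc x + 2) (R i + R i)) (m≤m+n _ _))

  first-below-pendant : 2 ≤ a → ∀ i → g i 0 + 2 ≤ suc (S + S)
  first-below-pendant 2≤a i = subst (λ s → g i 0 + 2 ≤ suc (s + s)) (sym (S-split i))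
                                (first-level<pendant (R i) (L i) (≤-trans 2≤a (m≤m+n a (toℕ i))))

  pendant-below-deeper : 1 ≤ k → ∀ i x → suc (S + S) + 2 ≤ g i (suc x)
  pendant-below-deeper 1≤k i x = ≤-trans (subst (λ s → suc (s + s) + 2 ≤ γ 2 (R i)) (sym (S-split i))
                                            (pendant<second-level (R i) (L i) (L≤R+1 1≤k i)))
                                         (γ-mono {2} {suc (suc x)} (R i) (s≤s (s≤s z≤n)))

  pendant-apart : 2 ≤ a → 1 ≤ k → ∀ i x → Apart (suc (S + S)) (g i x)
  pendant-apart 2≤a 1≤k i zero    = inj₂ (first-below-pendant 2≤a i)
  pendant-apart 2≤a 1≤k i (suc x) = inj₁ (pendant-below-deeper 1≤k i x)

  center-below-pendant : 2 ≤ a → 0 + 2 ≤ suc (S + S)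
  center-below-pendant 2≤a = ≤-trans (m≤n+m 2 (g Fin.zero 0)) (first-below-pendant 2≤a Fin.zero)

  hop-injective : ∀ b b' → hop true b ≡ hop true b' → b ≡ b'
  hop-injective true  true  _ = refl
  hop-injective false false _ = refl

  side≤1 : ∀ v → side v ≤ 1
  side≤1 (ctr true)      = z≤n
  side≤1 (ctr false)     = ≤-refl
  side≤1 pend            = z≤n
  side≤1 (pth true i j)  = z≤n
  side≤1 (pth false i j) = ≤-refl

  level-separated : 2 ≤ a → 1 ≤ k → ∀ u v →
                    (level u ≡ level v × (side u ≡ side v → u ≡ v)) ⊎ Apart (level u) (level v)
  level-separated 2≤a 1≤k (ctr b) (ctr b') = inj₁ (refl , λ e → cong ctr (hop-injective b b' e))
  level-separated 2≤a 1≤k (ctr b) pend = inj₂ (inj₁ (center-below-pendant 2≤a))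
  level-separated 2≤a 1≤k (ctr b) (pth b' i j) = inj₂ (inj₁ (2≤g i (toℕ j)))
  level-separated 2≤a 1≤k pend (ctr b) = inj₂ (inj₂ (center-below-pendant 2≤a))
  level-separated 2≤a 1≤k pend pend = inj₁ (refl , λ _ → refl)
  level-separated 2≤a 1≤k pend (pth b i j) = inj₂ (pendant-apart 2≤a 1≤k i (toℕ j))
  level-separated 2≤a 1≤k (pth b i j) (ctr b') = inj₂ (inj₂ (2≤g i (toℕ j)))
  level-separated 2≤a 1≤k (pth b i j) pend = inj₂ (apart-sym (pendant-apart 2≤a 1≤k i (toℕ j)))
  level-separated 2≤a 1≤k (pth b i j) (pth b' i' j') with g-separated i (toℕ j) i' (toℕ j') (toℕ<n j) (toℕ<n j')
  ... | inj₁ (refl , j≡j') = inj₁ (cong (g i) j≡j' ,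
                                   λ e → cong₂ (λ b j → pth b i j) (hop-injective b b' e) (toℕ-injective j≡j'))
  ... | inj₂ apart = inj₂ apart

  -- Tr is injective: equal transmissions force equal levels (apart levels cannot be
  -- compensated by offsets in {0, 1}), hence equal sides, hence equal vertices.
  Tr-injective : 2 ≤ a → 1 ≤ k → ∀ u v → Tr u ≡ Tr v → u ≡ v
  Tr-injective 2≤a 1≤k u v Tru≡Trv = conclude (level-separated 2≤a 1≤k u v)
    where
    offsets : level u + side u ≡ level v + side v
    offsets = +-cancelˡ-≡ K _ _ (trans (sym (transmission u)) (trans Tru≡Trv (transmission v)))
    conclude : (level u ≡ level v × (side u ≡ side v → u ≡ v)) ⊎ Apart (level u) (level v) → u ≡ v
    conclude (inj₁ (same-level , same-side⇒≡)) =
      same-side⇒≡ (+-cancelˡ-≡ (level u) _ _ (trans offsets (cong (_+ side v) (sym same-level))))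
    conclude (inj₂ apart) = ⊥-elim (apart-offsets (side≤1 u) (side≤1 v) apart offsets)

  irregular : (∀ u v → Tr u ≡ Tr v → u ≡ v) → TransmissionIrregular a k
  irregular Tr-inj = (λ v → Tr v , (λ u → δ u v) , (λ u → distance u v) , refl)
                   , (λ u v t u-has-t v-has-t →
                        Tr-inj u v (trans (sym (transmission-unique u t u-has-t)) (transmission-unique v t v-has-t)))

-- Theorem 3.6: BS*(a, a+1, …, a+k) is transmission irregular for a ≥ 2, k ≥ 2
-- (the argument only needs k ≥ 1).
theorem3p6 : (a k : ℕ) → 1 < a → 2 ≤ k → TransmissionIrregular a k
theorem3p6 a k 2≤a 2≤k = irregular (Tr-injective 2≤a (≤-trans (s≤s z≤n) 2≤k))
  where open Tree a k
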